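{- Let $G=(V,E)$ be a connected undirected graph with positive edge weights $c:E\to\mathbb{R}_+$, let $t\ge1$, and let $K$ be a set of unordered pairs of distinct vertices of $V$. Fix a total order on $V$ and write each pair in $K$ as $(u,v)$ with $u<v$. Let $E'$ be the set of directed edges obtained by replacing each $e=\{i,j\}\in E$ by the two arcs $(i,j)$ and $(j,i)$, each of weight $c_e$; for $i\in V$ let $In(i)$ and $Out(i)$ be the sets of arcs of $E'$ entering and leaving $i$. Consider the integer linear program with binary variables $x_e$ ($e\in E$) and $x^{uv}_{(i,j)}$ ($(u,v)\in K$, $(i,j)\in E'$): minimize $\sum_{e\in E}c_e x_e$ subject to (a) $\sum_{(i,j)\in E'} x^{uv}_{(i,j)}\,c_{\{i,j\}}\le t\cdot d_G(u,v)$ for all $(u,v)\in K$; (b) $\sum_{(i,j)\in Out(i)}x^{uv}_{(i,j)}-\sum_{(j,i)\in In(i)}x^{uv}_{(j,i)}$ equals $1$ if $i=u$, $-1$ if $i=v$, and $0$ otherwise, for all $(u,v)\in K$ and $i\in V$; (c) $\sum_{(i,j)\in Out(i)}x^{uv}_{(i,j)}\le 1$ for all $(u,v)\in K$ and $i\in V$; (d) $x^{uv}_{(i,j)}+x^{uv}_{(j,i)}\le x_e$ for all $(u,v)\in K$ and all $e=\{i,j\}\in E$; (e) $x_e,\,x^{uv}_{(i,j)}\in\{0,1\}$. Then for any optimal solution of this ILP, the subgraph $(V,\{e\in E: x_e=1\})$ is a minimum-cost pairwise spanner of $G$ over $K$ with stretch factor $t$ (and the optimal ILP value equals the minimum cost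 of such a spanner).
   Context: $d_G(u,v)$ is the length of a shortest $u$–$v$ path in $G$ with respect to $c$. A subgraph $H$ of $G$ is a pairwise spanner of $G$ over $K$ with stretch factor $t$ if $d_H(u,v)\le t\cdot d_G(u,v)$ for all $(u,v)\in K$; its cost is the sum of the weights of its edges.
   Formalization: The edge weights take positive rational values instead of values in $\mathbb{R}_+$, and the stretch factor $t$ is likewise rational. -}

module Defs where

open import Data.Nat using (ℕ; zero; suc)
open import Data.Fin using (Fin; zero; suc) renaming (_<_ to _<ᶠ_)
open import Data.Fin.Properties using () renaming (_≟_ to _≟ᶠ_)
open import Data.Bool using (Bool; true; false; if_then_else_)
open import Data.Product using (Σ; _×_; _,_; proj₁; proj₂; ∃)
open import Data.Sum using (_⊎_)
open import Data.Rational using (ℚ; 0ℚ; 1ℚ; _+_; _*_; _-_; -_; _≤_; _<_; _≟_)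
open import Relation.Nullary using (¬_; does)
open import Relation.Binary.PropositionalEquality using (_≡_; _≢_)

∑ : ∀ {m} → (Fin m → ℚ) → ℚ
∑ {zero}  f = 0ℚ
∑ {suc m} f = f zero + ∑ (λ i → f (suc i))

record Graph (n m : ℕ) : Set where
  field
    end₁ end₂ : Fin m → Fin n
    weight    : Fin m → ℚ
open Graph public

module _ {n m : ℕ} (G : Graph n m) where

  Loopless : Set
  Loopless = ∀ e → end₁ G e ≢ end₂ G e

  SameEnds : Fin m → Fin m → Set
  SameEnds e f = (end₁ G e ≡ end₁ G f × end₂ G e ≡ end₂ G f)
               ⊎ (end₁ G e ≡ end₂ G f × end₂ G e ≡ end₁ G f)

  Simple : Set
  Simple = ∀ e f → e ≢ f → ¬ SameEnds e f

  PositiveWeights : Set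
  PositiveWeights = ∀ e → 0ℚ < weight G e

  -- Arcs of E': edge e with direction; (e , false) = (end₁ e , end₂ e),
  -- (e , true) = (end₂ e , end₁ e).  Both have weight c_e.
  Arc : Set
  Arc = Fin m × Bool

  tail : Arc → Fin n
  tail (e , false) = end₁ G e
  tail (e , true)  = end₂ G e

  head : Arc → Fin n
  head (e , false) = end₂ G e
  head (e , true)  = end₁ G e

  -- A spanning subgraph (V , F) is given by its edge set F ⊆ E as a Bool mask.
  EdgeSet : Set
  EdgeSet = Fin m → Bool

  allEdges : EdgeSet
  allEdges _ = true

  data Walk (F : EdgeSet) : Fin n → Fin n → Set where
    stop : ∀ {u} → Walk F u u
    step : ∀ {u w} (a : Arc) → F (proj₁ a) ≡ true → tail a ≡ u
         → Walk F (head a) w → Walk F u w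

  len : ∀ {F u v} → Walk F u v → ℚ
  len stop             = 0ℚ
  len (step a _ _ rest) = weight G (proj₁ a) + len rest

  Connected : Set
  Connected = ∀ u v → Walk allEdges u v

  IsDistIn : EdgeSet → Fin n → Fin n → ℚ → Set
  IsDistIn F u v d = Σ (Walk F u v) (λ w → len w ≡ d)
                   × (∀ (w : Walk F u v) → d ≤ len w)

  IsDist : Fin n → Fin n → ℚ → Set
  IsDist = IsDistIn allEdges

  cost : EdgeSet → ℚ
  cost F = ∑ (λ e → if F e then weight G e else 0ℚ)

  module _ {k : ℕ} (K : Fin k → Fin n × Fin n) (t : ℚ) where

    pu pv : Fin k → Fin n
    pu κ = proj₁ (K κ)
    pv κ = proj₂ (K κ)

    IsSpanner : EdgeSet → Set
    IsSpanner F = ∀ κ d → IsDist (pu κ) (pv κ) d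
                → ∃ λ dF → IsDistIn F (pu κ) (pv κ) dF × dF ≤ t * d

    EVars : Set
    EVars = Fin m → ℚ

    FVars : Set
    FVars = Fin k → Arc → ℚ

    outFlow : FVars → Fin k → Fin n → ℚ
    outFlow y κ i = ∑ (λ e →
        (if does (tail (e , false) ≟ᶠ i) then y κ (e , false) else 0ℚ)
      + (if does (tail (e , true)  ≟ᶠ i) then y κ (e , true)  else 0ℚ))

    inFlow : FVars → Fin k → Fin n → ℚ
    inFlow y κ i = ∑ (λ e →
        (if does (head (e , false) ≟ᶠ i) then y κ (e , false) else 0ℚ)
      + (if does (head (e , true)  ≟ᶠ i) then y κ (e , true)  else 0ℚ))

    demand : Fin k → Fin n → ℚ
    demand κ i = if does (i ≟ᶠ pu κ) then 1ℚ
                 else (if does (i ≟ᶠ pv κ) then - 1ℚ else 0ℚ)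

    Binary : ℚ → Set
    Binary q = q ≡ 0ℚ ⊎ q ≡ 1ℚ

    record Feasible (x : EVars) (y : FVars) : Set where
      field
        ca : ∀ κ d → IsDist (pu κ) (pv κ) d
           → ∑ (λ e → y κ (e , false) * weight G e + y κ (e , true) * weight G e)
             ≤ t * d
        cb : ∀ κ i → outFlow y κ i - inFlow y κ i ≡ demand κ i
        cc : ∀ κ i → outFlow y κ i ≤ 1ℚ
        cd : ∀ κ e → y κ (e , false) + y κ (e , true) ≤ x e
        ce-x : ∀ e → Binary (x e)
        ce-y : ∀ κ a → Binary (y κ a)

    objective : EVars → ℚ
    objective x = ∑ (λ e → weight G e * x e)

    Optimal : EVars → FVars → Set
    Optimal x y = Feasible x y
                × (∀ x′ y′ → Feasible x′ y′ → objective x ≤ objective x′)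

    selected : EVars → EdgeSet
    selected x e = does (x e ≟ 1ℚ)

OrderedPairs : ∀ {n k} → (Fin k → Fin n × Fin n) → Set
OrderedPairs K = ∀ κ → proj₁ (K κ) <ᶠ proj₂ (K κ)

NoRepeats : ∀ {n k} → (Fin k → Fin n × Fin n) → Set
NoRepeats K = ∀ κ λ′ → K κ ≡ K λ′ → κ ≡ λ′

-- An optimal solution (x , y) gives a spanner: for every pair (u , v) the 0/1 flow y^{uv} carries one
-- unit from u to v, so v is reachable from u in the support of y^{uv} (otherwise the vertices reachable
-- from u would form a cut that no flow crosses, contradicting conservation).  A shortcut of such a walk
-- to a path uses only edges with x_e = 1, by (d), and costs at most the support, hence at most
-- ∑ c y^{uv} ≤ t · d_G(u , v) by (a).  Conversely a spanner F gives the feasible solution x = 1_F,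
-- y^{uv} = the arcs of a path in F of length at most t · d_G(u , v): (b) telescopes along any walk,
-- being a path gives (c)-(e), and the objective value is cost F.  Optimality of x then yields
-- cost (selected x) = objective x ≤ cost F.

module Submission where

open import Defs
open import Data.Nat using (ℕ)
open import Data.Fin using (Fin)
open import Data.Product using (_×_)
open import Data.Rational using (ℚ; 1ℚ; _≤_)
open import Relation.Binary.PropositionalEquality using (_≡_)

open import Algebra.Bundles using (CommutativeRing)
open import Data.Bool using (Bool; true; false; if_then_else_)
import Data.Bool.Properties as Bool
open import Data.Empty using (⊥-elim)
open import Data.Fin using (zero; suc)
open import Data.Fin.Properties using (suc-injective; injective⇒≤; any?; <⇒≢) renaming (_≟_ to _≟ᶠ_)
open import Data.List using (List; []; _∷_; _++_; map; concatMap; cartesianProduct; allFin)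
open import Data.List.Membership.Propositional using (_∈_; lose)
open import Data.List.Membership.Propositional.Properties using (∈-allFin; ∈-cartesianProduct⁺)
open import Data.List.Relation.Unary.Any as Any using (Any; here; there)
open import Data.List.Relation.Unary.Any.Properties using (¬Any[]; map⁺; ++⁺ˡ; ++⁺ʳ; concatMap⁺)
open import Data.Nat using (zero; suc; _<_; s≤s) renaming (_≤_ to _≤ℕ_)
open import Data.Nat.Properties using (<⇒≤)
open import Data.Product using (Σ; Σ-syntax; _,_; proj₁; proj₂)
open import Data.Product.Properties using (≡-dec)
open import Data.Rational using (0ℚ; _+_; _*_; _-_; _≤?_; _≟_; nonNegative)
open import Data.Rational.Properties
  using (≤-refl; ≤-trans; ≤-reflexive; ≤-antisym; ≤-decTotalOrder; module ≤-Reasoning;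
         +-comm; +-identityˡ; +-identityʳ; +-inverseʳ; +-mono-≤; +-monoˡ-≤; +-monoʳ-≤;
         *-comm; *-identityˡ; *-identityʳ; *-zeroˡ; *-zeroʳ; *-distribˡ-+; *-distribʳ-+; *-monoʳ-≤-nonNeg;
         +-0-group; +-*-commutativeRing)
  renaming (<⇒≤ to <⇒≤ℚ)
open import Data.Rational.Solver using (module +-*-Solver)
open import Data.Sum using (_⊎_; inj₁; inj₂)
open import Data.Unit using (⊤; tt)
open import Function using (_∘_)
open import Function.Definitions using (Injective)
open import Relation.Binary.Bundles using (DecTotalOrder)
open import Relation.Binary.PropositionalEquality
  using (_≢_; refl; sym; trans; cong; cong₂; subst; subst₂; module ≡-Reasoning)
open import Relation.Nullary using (Dec; yes; no; ¬_; does; from-yes; from-no)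
open import Relation.Nullary.Decidable using (_⊎-dec_; dec-true)

import Algebra.Properties.Semiring.Sum (CommutativeRing.semiring +-*-commutativeRing) as Sum
open import Algebra.Properties.Group +-0-group using (x∙y⁻¹≈ε⇒x≈y)
open import Data.List.Extrema (DecTotalOrder.totalOrder ≤-decTotalOrder) using (argmin; f[argmin]≤v⁺)
open +-*-Solver

𝟙 : ∀ {P : Set} → Dec P → ℚ
𝟙 d = if does d then 1ℚ else 0ℚ

𝟙-yes : ∀ {P : Set} (d : Dec P) → P → 𝟙 d ≡ 1ℚ
𝟙-yes (yes _) _ = refl
𝟙-yes (no ¬p) p = ⊥-elim (¬p p)

𝟙-no : ∀ {P : Set} (d : Dec P) → ¬ P → 𝟙 d ≡ 0ℚ
𝟙-no (yes p) ¬p = ⊥-elim (¬p p)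
𝟙-no (no _) _ = refl

𝟙-cong : ∀ {P Q : Set} → (P → Q) → (Q → P) → (d : Dec P) (d′ : Dec Q) → 𝟙 d ≡ 𝟙 d′
𝟙-cong to from (yes p) d′ = sym (𝟙-yes d′ (to p))
𝟙-cong to from (no ¬p) d′ = sym (𝟙-no d′ (¬p ∘ from))

𝟙-⊎ : ∀ {P Q : Set} (d : Dec P) (d′ : Dec Q) → ¬ (P × Q) → 𝟙 d + 𝟙 d′ ≡ 𝟙 (d ⊎-dec d′)
𝟙-⊎ (yes p) (yes q) ¬p×q = ⊥-elim (¬p×q (p , q))
𝟙-⊎ (yes _) (no _) _ = +-identityʳ 1ℚ
𝟙-⊎ (no _) (yes _) _ = +-identityˡ 1ℚ
𝟙-⊎ (no _) (no _) _ = +-identityˡ 0ℚ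

if-then-0≡* : ∀ b x → (if b then x else 0ℚ) ≡ (if b then 1ℚ else 0ℚ) * x
if-then-0≡* true x = sym (*-identityˡ x)
if-then-0≡* false x = sym (*-zeroˡ x)

*-if-then-0 : ∀ x b y → x * (if b then y else 0ℚ) ≡ (if b then 1ℚ else 0ℚ) * (x * y)
*-if-then-0 x true y = sym (*-identityˡ (x * y))
*-if-then-0 x false y = trans (*-zeroʳ x) (sym (*-zeroˡ (x * y)))

x≤y+x : ∀ {x y} → 0ℚ ≤ y → x ≤ y + x
x≤y+x {x} {y} 0≤y = subst (_≤ y + x) (+-identityˡ x) (+-monoˡ-≤ x 0≤y)

-- Binary G K t, stripped of its unused parameters.
Bit : ℚ → Set
Bit q = q ≡ 0ℚ ⊎ q ≡ 1ℚ

bit≥0 : ∀ {q} → Bit q → 0ℚ ≤ q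
bit≥0 (inj₁ refl) = ≤-refl
bit≥0 (inj₂ refl) = from-yes (0ℚ ≤? 1ℚ)

bit≤1 : ∀ {q} → Bit q → q ≤ 1ℚ
bit≤1 (inj₁ refl) = from-yes (0ℚ ≤? 1ℚ)
bit≤1 (inj₂ refl) = ≤-refl

bit≥1⇒≡1 : ∀ {q} → Bit q → 1ℚ ≤ q → q ≡ 1ℚ
bit≥1⇒≡1 (inj₁ refl) 1≤0 = ⊥-elim (from-no (1ℚ ≤? 0ℚ) 1≤0)
bit≥1⇒≡1 (inj₂ q≡1) _ = q≡1

∑-cong : ∀ {p} {f g : Fin p → ℚ} → (∀ i → f i ≡ g i) → ∑ f ≡ ∑ g
∑-cong {zero} _ = refl
∑-cong {suc p} f≗g = cong₂ _+_ (f≗g zero) (∑-cong (f≗g ∘ suc))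

∑-mono : ∀ {p} {f g : Fin p → ℚ} → (∀ i → f i ≤ g i) → ∑ f ≤ ∑ g
∑-mono {zero} _ = ≤-refl
∑-mono {suc p} f≤g = +-mono-≤ (f≤g zero) (∑-mono (f≤g ∘ suc))

∑≡sum : ∀ {p} (f : Fin p → ℚ) → ∑ f ≡ Sum.sum f
∑≡sum {zero} f = refl
∑≡sum {suc p} f = cong (f zero +_) (∑≡sum (f ∘ suc))

∑-distrib-+ : ∀ {p} (f g : Fin p → ℚ) → ∑ (λ i → f i + g i) ≡ ∑ f + ∑ g
∑-distrib-+ f g = begin
  ∑ (λ i → f i + g i)       ≡⟨ ∑≡sum (λ i → f i + g i) ⟩
  Sum.sum (λ i → f i + g i) ≡⟨ Sum.∑-distrib-+ f g ⟩
  Sum.sum f + Sum.sum g     ≡⟨ sym (cong₂ _+_ (∑≡sum f) (∑≡sum g)) ⟩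
  ∑ f + ∑ g                 ∎
  where open ≡-Reasoning

*-distribˡ-∑ : ∀ {p} x (f : Fin p → ℚ) → x * ∑ f ≡ ∑ (λ i → x * f i)
*-distribˡ-∑ x f = begin
  x * ∑ f                   ≡⟨ cong (x *_) (∑≡sum f) ⟩
  x * Sum.sum f             ≡⟨ Sum.*-distribˡ-sum x f ⟩
  Sum.sum (λ i → x * f i)   ≡⟨ sym (∑≡sum (λ i → x * f i)) ⟩
  ∑ (λ i → x * f i)         ∎
  where open ≡-Reasoning

∑-comm : ∀ {p q} (f : Fin p → Fin q → ℚ) → ∑ (λ i → ∑ (f i)) ≡ ∑ (λ j → ∑ (λ i → f i j))
∑-comm f = begin
  ∑ (λ i → ∑ (f i))                     ≡⟨ ∑-cong (∑≡sum ∘ f) ⟩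
  ∑ (λ i → Sum.sum (f i))               ≡⟨ ∑≡sum (λ i → Sum.sum (f i)) ⟩
  Sum.sum (λ i → Sum.sum (f i))         ≡⟨ Sum.∑-comm f ⟩
  Sum.sum (λ j → Sum.sum (λ i → f i j)) ≡⟨ sym (∑≡sum (λ j → Sum.sum (λ i → f i j))) ⟩
  ∑ (λ j → Sum.sum (λ i → f i j))       ≡⟨ sym (∑-cong (λ j → ∑≡sum (λ i → f i j))) ⟩
  ∑ (λ j → ∑ (λ i → f i j))             ∎
  where open ≡-Reasoning

∑-distrib-minus : ∀ {p} (f g : Fin p → ℚ) → ∑ (λ i → f i - g i) ≡ ∑ f - ∑ g
∑-distrib-minus {zero} f g = refl
∑-distrib-minus {suc p} f g =
  trans (cong (f zero - g zero +_) (∑-distrib-minus (f ∘ suc) (g ∘ suc)))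
        (solve 4 (λ a b c d → (a :- b) :+ (c :- d) := (a :+ c) :- (b :+ d)) refl
               (f zero) (g zero) (∑ (f ∘ suc)) (∑ (g ∘ suc)))

∑-zero : ∀ {p} {f : Fin p → ℚ} → (∀ i → f i ≡ 0ℚ) → ∑ f ≡ 0ℚ
∑-zero {zero} _ = refl
∑-zero {suc p} f≗0 = trans (cong₂ _+_ (f≗0 zero) (∑-zero (f≗0 ∘ suc))) (+-identityˡ 0ℚ)

∑-point : ∀ {p} {f : Fin p → ℚ} j → (∀ i → i ≢ j → f i ≡ 0ℚ) → ∑ f ≡ f j
∑-point {suc p} {f} zero rest≡0 =
  trans (cong (f zero +_) (∑-zero (λ i → rest≡0 (suc i) λ ()))) (+-identityʳ (f zero))
∑-point {suc p} {f} (suc j) rest≡0 =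
  trans (cong₂ _+_ (rest≡0 zero λ ()) (∑-point j λ i i≢j → rest≡0 (suc i) (i≢j ∘ suc-injective)))
        (+-identityˡ (f (suc j)))

∑-pick : ∀ {p} j (g : Fin p → ℚ) → ∑ (λ i → 𝟙 (j ≟ᶠ i) * g i) ≡ g j
∑-pick j g =
  trans (∑-point j λ i i≢j → trans (cong (_* g i) (𝟙-no (j ≟ᶠ i) (i≢j ∘ sym))) (*-zeroˡ (g i)))
        (trans (cong (_* g j) (𝟙-yes (j ≟ᶠ j) refl)) (*-identityˡ (g j)))

-- Summation over the arcs, shaped so that outFlow and inFlow are definitionally instances of flowAt.
∑ᴬ : ∀ {m} → (Fin m × Bool → ℚ) → ℚ
∑ᴬ g = ∑ (λ e → g (e , false) + g (e , true))

_≟ᴬ_ : ∀ {m} (a b : Fin m × Bool) → Dec (a ≡ b)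
_≟ᴬ_ = ≡-dec _≟ᶠ_ Bool._≟_

edgeUse : ∀ {m} → (Fin m × Bool → ℚ) → Fin m → ℚ
edgeUse f e = f (e , false) + f (e , true)

module _ {m : ℕ} where

  ∑ᴬ-cong : {f g : Fin m × Bool → ℚ} → (∀ a → f a ≡ g a) → ∑ᴬ f ≡ ∑ᴬ g
  ∑ᴬ-cong f≗g = ∑-cong λ e → cong₂ _+_ (f≗g (e , false)) (f≗g (e , true))

  ∑ᴬ-distrib-+ : (f g : Fin m × Bool → ℚ) → ∑ᴬ (λ a → f a + g a) ≡ ∑ᴬ f + ∑ᴬ g
  ∑ᴬ-distrib-+ f g =
    trans (∑-cong λ e → interchange (f (e , false)) (g (e , false)) (f (e , true)) (g (e , true)))
          (∑-distrib-+ (edgeUse f) (edgeUse g))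
    where
      interchange : ∀ a b c d → (a + b) + (c + d) ≡ (a + c) + (b + d)
      interchange = solve 4 (λ a b c d → (a :+ b) :+ (c :+ d) := (a :+ c) :+ (b :+ d)) refl

  ∑ᴬ-zero : {f : Fin m × Bool → ℚ} → (∀ a → f a ≡ 0ℚ) → ∑ᴬ f ≡ 0ℚ
  ∑ᴬ-zero f≗0 = ∑-zero λ e → trans (cong₂ _+_ (f≗0 (e , false)) (f≗0 (e , true))) (+-identityˡ 0ℚ)

  ∑ᴬ-point : {f : Fin m × Bool → ℚ} (b : Fin m × Bool) → (∀ a → a ≢ b → f a ≡ 0ℚ) → ∑ᴬ f ≡ f b
  ∑ᴬ-point {f} (e , β) rest≡0 =
    trans (∑-point e λ e′ e′≢e →
             trans (cong₂ _+_ (rest≡0 _ (e′≢e ∘ cong proj₁)) (rest≡0 _ (e′≢e ∘ cong proj₁)))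
                                      (+-identityˡ 0ℚ))
          (at-e β rest≡0)
    where
      at-e : ∀ β → (∀ a → a ≢ (e , β) → f a ≡ 0ℚ) → edgeUse f e ≡ f (e , β)
      at-e false rest≡0 = trans (cong (f (e , false) +_) (rest≡0 _ λ ())) (+-identityʳ _)
      at-e true rest≡0 = trans (cong (_+ f (e , true)) (rest≡0 _ λ ())) (+-identityˡ _)

  ∑ᴬ-pick : (b : Fin m × Bool) (g : Fin m × Bool → ℚ) → ∑ᴬ (λ a → 𝟙 (a ≟ᴬ b) * g a) ≡ g b
  ∑ᴬ-pick b g =
    trans (∑ᴬ-point b λ a a≢b → trans (cong (_* g a) (𝟙-no (a ≟ᴬ b) a≢b)) (*-zeroˡ (g a)))
          (trans (cong (_* g b) (𝟙-yes (b ≟ᴬ b) refl)) (*-identityˡ (g b)))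

  *-distribˡ-∑ᴬ : ∀ x (f : Fin m × Bool → ℚ) → x * ∑ᴬ f ≡ ∑ᴬ (λ a → x * f a)
  *-distribˡ-∑ᴬ x f = trans (*-distribˡ-∑ x (edgeUse f)) (∑-cong λ e → *-distribˡ-+ x (f (e , false)) (f (e , true)))

  ∑-∑ᴬ-comm : ∀ {p} (h : Fin p → Fin m × Bool → ℚ) → ∑ (λ i → ∑ᴬ (h i)) ≡ ∑ᴬ (λ a → ∑ (λ i → h i a))
  ∑-∑ᴬ-comm h = trans (∑-comm (λ i → edgeUse (h i)))
                      (∑-cong λ e → ∑-distrib-+ (λ i → h i (e , false)) (λ i → h i (e , true)))

-- Flows

flowAt : ∀ {n m} → (Fin m × Bool → Fin n) → (Fin m × Bool → ℚ) → Fin n → ℚ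
flowAt end f i = ∑ᴬ (λ a → if does (end a ≟ᶠ i) then f a else 0ℚ)

∑-potential : ∀ {n m} (end : Fin m × Bool → Fin n) (f : Fin m × Bool → ℚ) (φ : Fin n → ℚ) →
  ∑ (λ i → φ i * flowAt end f i) ≡ ∑ᴬ (λ a → φ (end a) * f a)
∑-potential end f φ = begin
  ∑ (λ i → φ i * ∑ᴬ (λ a → if does (end a ≟ᶠ i) then f a else 0ℚ))
    ≡⟨ ∑-cong (λ i → *-distribˡ-∑ᴬ (φ i) (λ a → if does (end a ≟ᶠ i) then f a else 0ℚ)) ⟩
  ∑ (λ i → ∑ᴬ (λ a → φ i * (if does (end a ≟ᶠ i) then f a else 0ℚ)))
    ≡⟨ ∑-∑ᴬ-comm (λ i a → φ i * (if does (end a ≟ᶠ i) then f a else 0ℚ)) ⟩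
  ∑ᴬ (λ a → ∑ (λ i → φ i * (if does (end a ≟ᶠ i) then f a else 0ℚ)))
    ≡⟨ ∑ᴬ-cong (λ a → trans (∑-cong λ i → *-if-then-0 (φ i) (does (end a ≟ᶠ i)) (f a))
                            (∑-pick (end a) (λ i → φ i * f a))) ⟩
  ∑ᴬ (λ a → φ (end a) * f a) ∎
  where open ≡-Reasoning

module _ {n m : ℕ} (G : Graph n m) where

  outOf inOf : (Arc G → ℚ) → Fin n → ℚ
  outOf = flowAt (tail G)
  inOf = flowAt (head G)

  Conserves : (Arc G → ℚ) → Fin n → Fin n → Set
  Conserves f u v = ∀ i → outOf f i - inOf f i ≡ 𝟙 (u ≟ᶠ i) - 𝟙 (v ≟ᶠ i)

  -- Summation by parts: ∑ᵢ φ i (out i - in i) = ∑ₐ f a (φ (tail a) - φ (head a)).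
  conserves⇒balanced : ∀ f (φ : Fin n → ℚ) {u v} → Conserves f u v →
    (∀ a → f a ≡ 0ℚ ⊎ φ (tail G a) ≡ φ (head G a)) → φ u ≡ φ v
  conserves⇒balanced f φ {u} {v} conserves balanced = x∙y⁻¹≈ε⇒x≈y (φ u) (φ v) (begin
    φ u - φ v
      ≡⟨ sym (cong₂ _-_ (∑-pick u φ) (∑-pick v φ)) ⟩
    ∑ (λ i → 𝟙 (u ≟ᶠ i) * φ i) - ∑ (λ i → 𝟙 (v ≟ᶠ i) * φ i)
      ≡⟨ sym (∑-distrib-minus (λ i → 𝟙 (u ≟ᶠ i) * φ i) (λ i → 𝟙 (v ≟ᶠ i) * φ i)) ⟩
    ∑ (λ i → 𝟙 (u ≟ᶠ i) * φ i - 𝟙 (v ≟ᶠ i) * φ i)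
      ≡⟨ ∑-cong (λ i → trans (factor (𝟙 (u ≟ᶠ i)) (𝟙 (v ≟ᶠ i)) (φ i)) (cong (φ i *_) (sym (conserves i)))) ⟩
    ∑ (λ i → φ i * (outOf f i - inOf f i))
      ≡⟨ ∑-cong (λ i → distrib (φ i) (outOf f i) (inOf f i)) ⟩
    ∑ (λ i → φ i * outOf f i - φ i * inOf f i)
      ≡⟨ ∑-distrib-minus (λ i → φ i * outOf f i) (λ i → φ i * inOf f i) ⟩
    ∑ (λ i → φ i * outOf f i) - ∑ (λ i → φ i * inOf f i)
      ≡⟨ cong₂ _-_ (∑-potential (tail G) f φ) (∑-potential (head G) f φ) ⟩
    ∑ᴬ (λ a → φ (tail G a) * f a) - ∑ᴬ (λ a → φ (head G a) * f a)
      ≡⟨ cong (_- ∑ᴬ (λ a → φ (head G a) * f a)) (∑ᴬ-cong λ a → balanced′ a (balanced a)) ⟩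
    ∑ᴬ (λ a → φ (head G a) * f a) - ∑ᴬ (λ a → φ (head G a) * f a)
      ≡⟨ +-inverseʳ (∑ᴬ (λ a → φ (head G a) * f a)) ⟩
    0ℚ ∎)
    where
      open ≡-Reasoning
      factor : ∀ p q x → p * x - q * x ≡ x * (p - q)
      factor = solve 3 (λ p q x → p :* x :- q :* x := x :* (p :- q)) refl
      distrib : ∀ x p q → x * (p - q) ≡ x * p - x * q
      distrib = solve 3 (λ x p q → x :* (p :- q) := x :* p :- x :* q) refl
      balanced′ : ∀ a → f a ≡ 0ℚ ⊎ φ (tail G a) ≡ φ (head G a) → φ (tail G a) * f a ≡ φ (head G a) * f a
      balanced′ a (inj₁ fa≡0) = trans (cong (φ (tail G a) *_) fa≡0)
        (trans (*-zeroʳ (φ (tail G a))) (sym (trans (cong (φ (head G a) *_) fa≡0) (*-zeroʳ (φ (head G a))))))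
      balanced′ a (inj₂ φt≡φh) = cong (_* f a) φt≡φh

  -- Walks and paths

  size : ∀ {F u v} → Walk G F u v → ℕ
  size stop = zero
  size (step _ _ _ r) = suc (size r)

  vertex : ∀ {F u v} (w : Walk G F u v) → Fin (suc (size w)) → Fin n
  vertex {u = u} _ zero = u
  vertex (step _ _ _ r) (suc i) = vertex r i

  _∉ᵛ_ : ∀ {F u v} → Fin n → Walk G F u v → Set
  z ∉ᵛ w = ∀ i → vertex w i ≢ z

  IsPath : ∀ {F u v} → Walk G F u v → Set
  IsPath stop = ⊤
  IsPath {u = u} (step _ _ _ r) = u ∉ᵛ r × IsPath r

  vertex-injective : ∀ {F u v} (w : Walk G F u v) → IsPath w → Injective _≡_ _≡_ (vertex w)
  vertex-injective _ _ {zero} {zero} _ = refl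
  vertex-injective (step _ _ _ r) (u∉r , _) {zero} {suc j} u≡rⱼ = ⊥-elim (u∉r j (sym u≡rⱼ))
  vertex-injective (step _ _ _ r) (u∉r , _) {suc i} {zero} rᵢ≡u = ⊥-elim (u∉r i rᵢ≡u)
  vertex-injective (step _ _ _ r) (_ , path) {suc i} {suc j} rᵢ≡rⱼ = cong suc (vertex-injective r path rᵢ≡rⱼ)

  path⇒size<n : ∀ {F u v} (w : Walk G F u v) → IsPath w → size w < n
  path⇒size<n w path = injective⇒≤ (vertex-injective w path)

  along : ∀ {F u v} → Walk G F u v → (Arc G → ℚ) → ℚ
  along stop c = 0ℚ
  along (step a _ _ r) c = c a + along r c

  len≡along : ∀ {F u v} (w : Walk G F u v) → len G w ≡ along w (weight G ∘ proj₁)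
  len≡along stop = refl
  len≡along (step a _ _ r) = cong (weight G (proj₁ a) +_) (len≡along r)

  along-cong : ∀ {F u v} (w : Walk G F u v) {c c′ : Arc G → ℚ} → (∀ a → c a ≡ c′ a) → along w c ≡ along w c′
  along-cong stop _ = refl
  along-cong (step a _ _ r) c≗c′ = cong₂ _+_ (c≗c′ a) (along-cong r c≗c′)

  along-distrib-+ : ∀ {F u v} (w : Walk G F u v) (c c′ : Arc G → ℚ) →
    along w (λ a → c a + c′ a) ≡ along w c + along w c′
  along-distrib-+ stop _ _ = sym (+-identityˡ 0ℚ)
  along-distrib-+ (step a _ _ r) c c′ = trans (cong (c a + c′ a +_) (along-distrib-+ r c c′))
    (solve 4 (λ x y z w → (x :+ y) :+ (z :+ w) := (x :+ z) :+ (y :+ w)) refl (c a) (c′ a) (along r c) (along r c′))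

  along-outside : ∀ {F u v} (w : Walk G F u v) (c : Arc G → ℚ) →
    (∀ a → F (proj₁ a) ≡ true → c a ≡ 0ℚ) → along w c ≡ 0ℚ
  along-outside stop _ _ = refl
  along-outside (step a p _ r) c c≡0 = trans (cong₂ _+_ (c≡0 a p) (along-outside r c c≡0)) (+-identityˡ 0ℚ)

  Touches : Arc G → Fin n → Set
  Touches a z = tail G a ≡ z ⊎ head G a ≡ z

  along-avoiding : ∀ {F u v z} (w : Walk G F u v) → z ∉ᵛ w →
    (c : Arc G → ℚ) → (∀ a → ¬ Touches a z → c a ≡ 0ℚ) → along w c ≡ 0ℚ
  along-avoiding stop _ _ _ = refl
  along-avoiding {z = z} (step a _ q r) z∉w c c≡0 =
    trans (cong₂ _+_ (c≡0 a a-avoids) (along-avoiding r (z∉w ∘ suc) c c≡0)) (+-identityˡ 0ℚ)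
    where
      a-avoids : ¬ Touches a z
      a-avoids (inj₁ tail≡z) = z∉w zero (trans (sym q) tail≡z)
      a-avoids (inj₂ head≡z) = z∉w (suc zero) head≡z

  -- A path never returns to a vertex it has left, so it uses at most one arc of a family whose
  -- arcs all touch the tail of each member.
  path-along-bit : ∀ {F u v} (w : Walk G F u v) → IsPath w → {P : Arc G → Set} (P? : ∀ a → Dec (P a)) →
    (∀ a b → P a → P b → Touches b (tail G a)) → Bit (along w (λ a → 𝟙 (P? a)))
  path-along-bit stop _ _ _ = inj₁ refl
  path-along-bit (step a _ q r) (u∉r , path) {P} P? clustered with P? a
  ... | yes Pa = inj₂ (trans (cong (1ℚ +_) (along-avoiding r u∉r (λ b → 𝟙 (P? b)) b∉P)) (+-identityʳ 1ℚ))
    where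
      b∉P : ∀ b → ¬ Touches b _ → 𝟙 (P? b) ≡ 0ℚ
      b∉P b b-avoids = 𝟙-no (P? b) (λ Pb → b-avoids (subst (Touches b) q (clustered a b Pa Pb)))
  ... | no _ = subst Bit (sym (+-identityˡ _)) (path-along-bit r path P? clustered)

  arcUse : ∀ {F u v} → Walk G F u v → Arc G → ℚ
  arcUse w a = along w (λ b → 𝟙 (a ≟ᴬ b))

  ∑ᴬ-arcUse : ∀ {F u v} (w : Walk G F u v) (c : Arc G → ℚ) → ∑ᴬ (λ a → arcUse w a * c a) ≡ along w c
  ∑ᴬ-arcUse stop c = ∑ᴬ-zero (λ a → *-zeroˡ (c a))
  ∑ᴬ-arcUse (step b _ _ r) c = begin
    ∑ᴬ (λ a → (𝟙 (a ≟ᴬ b) + arcUse r a) * c a)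
      ≡⟨ ∑ᴬ-cong (λ a → *-distribʳ-+ (c a) (𝟙 (a ≟ᴬ b)) (arcUse r a)) ⟩
    ∑ᴬ (λ a → 𝟙 (a ≟ᴬ b) * c a + arcUse r a * c a)
      ≡⟨ ∑ᴬ-distrib-+ (λ a → 𝟙 (a ≟ᴬ b) * c a) (λ a → arcUse r a * c a) ⟩
    ∑ᴬ (λ a → 𝟙 (a ≟ᴬ b) * c a) + ∑ᴬ (λ a → arcUse r a * c a)
      ≡⟨ cong₂ _+_ (∑ᴬ-pick b c) (∑ᴬ-arcUse r c) ⟩
    c b + along r c ∎
    where open ≡-Reasoning

  flowAt-arcUse : ∀ {F u v} (w : Walk G F u v) (end : Arc G → Fin n) i →
    flowAt end (arcUse w) i ≡ along w (λ a → 𝟙 (end a ≟ᶠ i))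
  flowAt-arcUse w end i =
    trans (∑ᴬ-cong λ a → trans (if-then-0≡* (does (end a ≟ᶠ i)) (arcUse w a)) (*-comm (𝟙 (end a ≟ᶠ i)) (arcUse w a)))
          (∑ᴬ-arcUse w (λ a → 𝟙 (end a ≟ᶠ i)))

  along-telescopes : ∀ {F u v} (w : Walk G F u v) i →
    along w (λ a → 𝟙 (tail G a ≟ᶠ i)) - along w (λ a → 𝟙 (head G a ≟ᶠ i)) ≡ 𝟙 (u ≟ᶠ i) - 𝟙 (v ≟ᶠ i)
  along-telescopes {u = u} stop i = trans (+-inverseʳ 0ℚ) (sym (+-inverseʳ (𝟙 (u ≟ᶠ i))))
  along-telescopes {u = u} {v} (step a _ q r) i = begin
    (T + Tr) - (H + Hr) ≡⟨ solve 4 (λ T Tr H Hr → (T :+ Tr) :- (H :+ Hr) := (T :- H) :+ (Tr :- Hr)) refl T Tr H Hr ⟩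
    (T - H) + (Tr - Hr) ≡⟨ cong ((T - H) +_) (along-telescopes r i) ⟩
    (T - H) + (H - V)   ≡⟨ solve 3 (λ T H V → (T :- H) :+ (H :- V) := T :- V) refl T H V ⟩
    T - V               ≡⟨ cong (λ z → 𝟙 (z ≟ᶠ i) - V) q ⟩
    𝟙 (u ≟ᶠ i) - V      ∎
    where
      open ≡-Reasoning
      T H V Tr Hr : ℚ
      T = 𝟙 (tail G a ≟ᶠ i)
      H = 𝟙 (head G a ≟ᶠ i)
      V = 𝟙 (v ≟ᶠ i)
      Tr = along r (λ b → 𝟙 (tail G b ≟ᶠ i))
      Hr = along r (λ b → 𝟙 (head G b ≟ᶠ i))

  arcUse-conserves : ∀ {F u v} (w : Walk G F u v) → Conserves (arcUse w) u v
  arcUse-conserves w i =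
    trans (cong₂ _-_ (flowAt-arcUse w (tail G) i) (flowAt-arcUse w (head G) i)) (along-telescopes w i)

  arcUse-bit : ∀ {F u v} (w : Walk G F u v) → IsPath w → ∀ a → Bit (arcUse w a)
  arcUse-bit w path a = path-along-bit w path (a ≟ᴬ_) λ { _ _ refl refl → inj₁ refl }

  path-outOf≤1 : ∀ {F u v} (w : Walk G F u v) → IsPath w → ∀ i → outOf (arcUse w) i ≤ 1ℚ
  path-outOf≤1 w path i = subst (_≤ 1ℚ) (sym (flowAt-arcUse w (tail G) i))
    (bit≤1 (path-along-bit w path (λ a → tail G a ≟ᶠ i)
                                λ _ _ tailᵃ≡i tailᵇ≡i → inj₁ (trans tailᵇ≡i (sym tailᵃ≡i))))

  edge-arcs-touch : ∀ e a b → (e , false) ≡ a ⊎ (e , true) ≡ a → (e , false) ≡ b ⊎ (e , true) ≡ b →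
    Touches b (tail G a)
  edge-arcs-touch e _ _ (inj₁ refl) (inj₁ refl) = inj₁ refl
  edge-arcs-touch e _ _ (inj₁ refl) (inj₂ refl) = inj₂ refl
  edge-arcs-touch e _ _ (inj₂ refl) (inj₁ refl) = inj₂ refl
  edge-arcs-touch e _ _ (inj₂ refl) (inj₂ refl) = inj₁ refl

  path-edgeUse≤ : ∀ {F u v} (w : Walk G F u v) → IsPath w → ∀ e → edgeUse (arcUse w) e ≤ (if F e then 1ℚ else 0ℚ)
  path-edgeUse≤ {F} w path e = subst (_≤ (if F e then 1ℚ else 0ℚ)) (sym edgeUse≡) (bound (F e) refl)
    where
      e-arc? : ∀ b → Dec ((e , false) ≡ b ⊎ (e , true) ≡ b)
      e-arc? b = ((e , false) ≟ᴬ b) ⊎-dec ((e , true) ≟ᴬ b)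
      edgeUse≡ : edgeUse (arcUse w) e ≡ along w (λ b → 𝟙 (e-arc? b))
      edgeUse≡ = trans (sym (along-distrib-+ w _ _))
                       (along-cong w λ b → 𝟙-⊎ ((e , false) ≟ᴬ b) ((e , true) ≟ᴬ b) λ { (refl , ()) })
      true≢false : true ≢ false
      true≢false ()
      bound : ∀ β → F e ≡ β → along w (λ b → 𝟙 (e-arc? b)) ≤ (if β then 1ℚ else 0ℚ)
      bound true _ = bit≤1 (path-along-bit w path e-arc? (edge-arcs-touch e))
      bound false Fe≡false = ≤-reflexive (along-outside w _ λ b Fb≡true → 𝟙-no (e-arc? b) λ
        { (inj₁ refl) → true≢false (trans (sym Fb≡true) Fe≡false)
        ; (inj₂ refl) → true≢false (trans (sym Fb≡true) Fe≡false) })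

  path-len≤cost : (∀ e → 0ℚ ≤ weight G e) → ∀ {F u v} (w : Walk G F u v) → IsPath w → len G w ≤ cost G F
  path-len≤cost weight≥0 {F} w path = begin
    len G w                                         ≡⟨ len≡along w ⟩
    along w (weight G ∘ proj₁)                      ≡⟨ sym (∑ᴬ-arcUse w (weight G ∘ proj₁)) ⟩
    ∑ᴬ (λ a → arcUse w a * weight G (proj₁ a))
      ≡⟨ ∑-cong (λ e → sym (*-distribʳ-+ (weight G e) (arcUse w (e , false)) (arcUse w (e , true)))) ⟩
    ∑ (λ e → edgeUse (arcUse w) e * weight G e)
      ≤⟨ ∑-mono (λ e → *-monoʳ-≤-nonNeg (weight G e) {{nonNegative (weight≥0 e)}} (path-edgeUse≤ w path e)) ⟩
    ∑ (λ e → (if F e then 1ℚ else 0ℚ) * weight G e) ≡⟨ ∑-cong (λ e → sym (if-then-0≡* (F e) (weight G e))) ⟩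
    cost G F                                        ∎
    where open ≤-Reasoning

  weaken : ∀ {F F′ : EdgeSet G} {u v} → (∀ e → F e ≡ true → F′ e ≡ true) → Walk G F u v → Walk G F′ u v
  weaken _ stop = stop
  weaken F⊆F′ (step a p q r) = step a (F⊆F′ (proj₁ a) p) q (weaken F⊆F′ r)

  len-weaken : ∀ {F F′ : EdgeSet G} {u v} (F⊆F′ : ∀ e → F e ≡ true → F′ e ≡ true) (w : Walk G F u v) →
    len G (weaken F⊆F′ w) ≡ len G w
  len-weaken _ stop = refl
  len-weaken F⊆F′ (step a _ _ r) = cong (weight G (proj₁ a) +_) (len-weaken F⊆F′ r)

  extend : ∀ {F u w} (a : Arc G) → F (proj₁ a) ≡ true → tail G a ≡ w → Walk G F u w → Walk G F u (head G a)
  extend a p q stop = step a p q stop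
  extend a p q (step b p′ q′ r) = step b p′ q′ (extend a p q r)

  extend-backwards : ∀ {F u} (a : Arc G) → F (proj₁ a) ≡ true → Walk G F u (head G a) → Walk G F u (tail G a)
  extend-backwards (e , false) p = extend (e , true) p refl
  extend-backwards (e , true) p = extend (e , false) p refl

  -- The arcs of s form a sub-multiset of those of w.
  _≼_ : ∀ {F F′ : EdgeSet G} {u v u′ v′} → Walk G F u v → Walk G F′ u′ v′ → Set
  s ≼ w = ∀ c → (∀ a → 0ℚ ≤ c a) → along s c ≤ along w c

  ≼⇒len≤ : (∀ e → 0ℚ ≤ weight G e) →
    ∀ {F F′ : EdgeSet G} {u v u′ v′} (s : Walk G F u v) (w : Walk G F′ u′ v′) → s ≼ w → len G s ≤ len G w
  ≼⇒len≤ weight≥0 s w s≼w =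
    subst₂ _≤_ (sym (len≡along s)) (sym (len≡along w)) (s≼w (weight G ∘ proj₁) (weight≥0 ∘ proj₁))

  suffix : ∀ {F u v} (w : Walk G F u v) (i : Fin (suc (size w))) → Walk G F (vertex w i) v
  suffix w zero = w
  suffix (step _ _ _ r) (suc i) = suffix r i

  suffix-≼ : ∀ {F u v} (w : Walk G F u v) i → suffix w i ≼ w
  suffix-≼ w zero _ _ = ≤-refl
  suffix-≼ (step a _ _ r) (suc i) c c≥0 = ≤-trans (suffix-≼ r i c c≥0) (x≤y+x (c≥0 a))

  suffix-path : ∀ {F u v} (w : Walk G F u v) → IsPath w → ∀ i → IsPath (suffix w i)
  suffix-path w path zero = path
  suffix-path (step _ _ _ r) (_ , path) (suc i) = suffix-path r path i

  simplify : ∀ {F u v} (w : Walk G F u v) → Σ[ s ∈ Walk G F u v ] IsPath s × s ≼ w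
  simplify stop = stop , tt , λ _ _ → ≤-refl
  simplify {u = u} (step a p q r) with simplify r
  ... | s , path , s≼r with any? (λ i → vertex s i ≟ᶠ u)
  ...   | yes (i , sᵢ≡u) = shortcut i sᵢ≡u
    where
      shortcut : ∀ {z} i → vertex s i ≡ z → Σ[ s′ ∈ Walk G _ z _ ] IsPath s′ × s′ ≼ step a p q r
      shortcut i refl = suffix s i , suffix-path s path i ,
        λ c c≥0 → ≤-trans (suffix-≼ s i c c≥0) (≤-trans (s≼r c c≥0) (x≤y+x (c≥0 a)))
  ...   | no u∉s = step a p q s , ((λ i sᵢ≡u → u∉s (i , sᵢ≡u)) , path) , λ c c≥0 → +-monoʳ-≤ (c a) (s≼r c c≥0)

  module _ (F : EdgeSet G) where

    arcs : List (Arc G)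
    arcs = cartesianProduct (allFin m) (false ∷ true ∷ [])

    ∈-arcs : ∀ a → a ∈ arcs
    ∈-arcs (e , false) = ∈-cartesianProduct⁺ (∈-allFin e) (here refl)
    ∈-arcs (e , true) = ∈-cartesianProduct⁺ (∈-allFin e) (there (here refl))

    trivialWalks : ∀ u v → List (Walk G F u v)
    trivialWalks u v with u ≟ᶠ v
    ... | yes refl = stop ∷ []
    ... | no _ = []

    walksUpTo : ℕ → ∀ u v → List (Walk G F u v)
    extensions : ℕ → ∀ u v → Arc G → List (Walk G F u v)
    walksUpTo zero u v = trivialWalks u v
    walksUpTo (suc k) u v = trivialWalks u v ++ concatMap (extensions k u v) arcs
    extensions k u v a with F (proj₁ a) Bool.≟ true | tail G a ≟ᶠ u
    ... | yes p | yes q = map (step a p q) (walksUpTo k (head G a) v)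
    ... | _ | _ = []

    stop∈trivialWalks : ∀ u → Any (λ w → len G w ≡ 0ℚ) (trivialWalks u u)
    stop∈trivialWalks u with u ≟ᶠ u
    ... | yes refl = here refl
    ... | no u≢u = ⊥-elim (u≢u refl)

    extensions-complete : ∀ k {u v ℓ} a → F (proj₁ a) ≡ true → tail G a ≡ u →
      Any (λ w → len G w ≡ ℓ) (walksUpTo k (head G a) v) →
      Any (λ w → len G w ≡ weight G (proj₁ a) + ℓ) (extensions k u v a)
    extensions-complete k {u} a p q found with F (proj₁ a) Bool.≟ true | tail G a ≟ᶠ u
    ... | yes _ | yes _ = map⁺ (Any.map (cong (weight G (proj₁ a) +_)) found)
    ... | no ¬p | _ = ⊥-elim (¬p p)
    ... | yes _ | no ¬q = ⊥-elim (¬q q)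

    walksUpTo-complete : ∀ k {u v} (w : Walk G F u v) → size w ≤ℕ k →
      Any (λ w′ → len G w′ ≡ len G w) (walksUpTo k u v)
    walksUpTo-complete zero stop _ = stop∈trivialWalks _
    walksUpTo-complete (suc k) stop _ = ++⁺ˡ (stop∈trivialWalks _)
    walksUpTo-complete (suc k) {u} (step a p q r) (s≤s size≤k) = ++⁺ʳ (trivialWalks u _)
      (concatMap⁺ (extensions k u _) (lose (∈-arcs a) (extensions-complete k a p q (walksUpTo-complete k r size≤k))))

    path-enumerated : ∀ {u v} (w : Walk G F u v) → IsPath w → Any (λ w′ → len G w′ ≡ len G w) (walksUpTo n u v)
    path-enumerated w path = walksUpTo-complete n w (<⇒≤ (path⇒size<n w path))

    walk? : ∀ u v → Dec (Walk G F u v)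
    walk? u v = decide (walksUpTo n u v) λ w → let s , path , _ = simplify w in path-enumerated s path
      where
        decide : ∀ {P : Walk G F u v → Walk G F u v → Set} ws → (∀ w → Any (P w) ws) → Dec (Walk G F u v)
        decide [] complete = no (λ w → ¬Any[] (complete w))
        decide (w ∷ _) _ = yes w

    shortest : (∀ e → 0ℚ ≤ weight G e) → ∀ {u v} → Walk G F u v → Σ ℚ (IsDistIn G F u v)
    shortest weight≥0 {u} {v} w₀ = len G best , (best , refl) , best≤
      where
        best : Walk G F u v
        best = argmin (len G) w₀ (walksUpTo n u v)
        best≤ : ∀ w → len G best ≤ len G w
        best≤ w with simplify w
        ... | s , path , s≼w =
          ≤-trans (f[argmin]≤v⁺ w₀ (walksUpTo n u v) (inj₂ (Any.map ≤-reflexive (path-enumerated s path))))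
                  (≼⇒len≤ weight≥0 s w s≼w)

  IsDistIn-unique : ∀ {F u v d d′} → IsDistIn G F u v d → IsDistIn G F u v d′ → d ≡ d′
  IsDistIn-unique ((w , len≡d) , d≤) ((w′ , len≡d′) , d′≤) =
    ≤-antisym (subst (_ ≤_) len≡d′ (d≤ w′)) (subst (_ ≤_) len≡d (d′≤ w))

  support : (Arc G → ℚ) → EdgeSet G
  support f e = does (1ℚ ≤? edgeUse f e)

  -- The indicator of the vertices reachable from u in the support of f is constant along every arc
  -- carrying flow, so by conservation it takes the same value 1 at v.
  flow⇒walk : ∀ f {u v} → (∀ a → Bit (f a)) → Conserves f u v → Walk G (support f) u v
  flow⇒walk f {u} {v} bits conserves with walk? (support f) u v
  ... | yes w = w
  ... | no ¬w = ⊥-elim (1≢0 (trans (sym (𝟙-yes (reach? u) stop)) (trans reach-balanced (𝟙-no (reach? v) ¬w))))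
    where
      reach? : ∀ i → Dec (Walk G (support f) u i)
      reach? = walk? (support f) u
      1≢0 : 1ℚ ≢ 0ℚ
      1≢0 ()
      f≤edgeUse : ∀ a → f a ≤ edgeUse f (proj₁ a)
      f≤edgeUse (e , false) =
        subst (f (e , false) ≤_) (+-comm (f (e , true)) (f (e , false))) (x≤y+x (bit≥0 (bits (e , true))))
      f≤edgeUse (e , true) = x≤y+x (bit≥0 (bits (e , false)))
      in-support : ∀ a → f a ≡ 1ℚ → support f (proj₁ a) ≡ true
      in-support a fa≡1 = dec-true (1ℚ ≤? edgeUse f (proj₁ a)) (subst (_≤ edgeUse f (proj₁ a)) fa≡1 (f≤edgeUse a))
      reach-balanced′ : ∀ a → Bit (f a) → f a ≡ 0ℚ ⊎ 𝟙 (reach? (tail G a)) ≡ 𝟙 (reach? (head G a))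
      reach-balanced′ a (inj₁ fa≡0) = inj₁ fa≡0
      reach-balanced′ a (inj₂ fa≡1) =
        inj₂ (𝟙-cong (extend a (in-support a fa≡1) refl) (extend-backwards a (in-support a fa≡1)) (reach? _) (reach? _))
      reach-balanced : 𝟙 (reach? u) ≡ 𝟙 (reach? v)
      reach-balanced = conserves⇒balanced f (𝟙 ∘ reach?) conserves λ a → reach-balanced′ a (bits a)

  support-cost≤ : (∀ e → 0ℚ ≤ weight G e) → ∀ f → (∀ a → 0ℚ ≤ f a) →
    cost G (support f) ≤ ∑ᴬ (λ a → f a * weight G (proj₁ a))
  support-cost≤ weight≥0 f f≥0 = ∑-mono λ e →
    subst ((if support f e then weight G e else 0ℚ) ≤_) (*-distribʳ-+ (weight G e) (f (e , false)) (f (e , true)))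
      (thresholded (1ℚ ≤? edgeUse f e) (+-mono-≤ (f≥0 (e , false)) (f≥0 (e , true))) (weight≥0 e))
    where
      thresholded : ∀ {q w} (1≤?q : Dec (1ℚ ≤ q)) → 0ℚ ≤ q → 0ℚ ≤ w → (if does 1≤?q then w else 0ℚ) ≤ q * w
      thresholded {q} {w} (yes 1≤q) _ 0≤w = subst (_≤ q * w) (*-identityˡ w) (*-monoʳ-≤-nonNeg w {{nonNegative 0≤w}} 1≤q)
      thresholded {q} {w} (no _) 0≤q 0≤w = subst (_≤ q * w) (*-zeroˡ w) (*-monoʳ-≤-nonNeg w {{nonNegative 0≤w}} 0≤q)

-- The integer program

objective≡cost : ∀ {n m k} (G : Graph n m) (K : Fin k → Fin n × Fin n) (t : ℚ) x →
  (∀ e → Bit (x e)) → objective G K t x ≡ cost G (selected G K t x)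
objective≡cost G K t x bits = ∑-cong λ e → weighted-bit (weight G e) (bits e)
  where
    weighted-bit : ∀ w {q} → Bit q → w * q ≡ (if does (q ≟ 1ℚ) then w else 0ℚ)
    weighted-bit w (inj₁ refl) = *-zeroʳ w
    weighted-bit w (inj₂ refl) = *-identityʳ w

module Formulation {n m k : ℕ} (G : Graph n m) (K : Fin k → Fin n × Fin n) (t : ℚ)
  (weight≥0 : ∀ e → 0ℚ ≤ weight G e) (distinct : ∀ κ → pu G K t κ ≢ pv G K t κ) where

  demand≡ : ∀ κ i → demand G K t κ i ≡ 𝟙 (pu G K t κ ≟ᶠ i) - 𝟙 (pv G K t κ ≟ᶠ i)
  demand≡ κ i with i ≟ᶠ pu G K t κ | i ≟ᶠ pv G K t κ
  ... | yes i≡u | yes i≡v = ⊥-elim (distinct κ (trans (sym i≡u) i≡v))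
  ... | yes i≡u | no i≢v = sym (cong₂ _-_ (𝟙-yes (_ ≟ᶠ i) (sym i≡u)) (𝟙-no (_ ≟ᶠ i) (i≢v ∘ sym)))
  ... | no i≢u | yes i≡v = sym (cong₂ _-_ (𝟙-no (_ ≟ᶠ i) (i≢u ∘ sym)) (𝟙-yes (_ ≟ᶠ i) (sym i≡v)))
  ... | no i≢u | no i≢v = sym (cong₂ _-_ (𝟙-no (_ ≟ᶠ i) (i≢u ∘ sym)) (𝟙-no (_ ≟ᶠ i) (i≢v ∘ sym)))

  feasible⇒spanner : ∀ {x y} → Feasible G K t x y → IsSpanner G K t (selected G K t x)
  feasible⇒spanner {x} {y} feasible κ d d-dist = dF , dF-dist , ≤-trans (proj₂ dF-dist s′) s′-short
    where
      open Feasible feasible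
      u v : Fin n
      u = pu G K t κ
      v = pv G K t κ
      S : EdgeSet G
      S = support G (y κ)
      S⊆selected : ∀ e → S e ≡ true → selected G K t x e ≡ true
      S⊆selected e inS =
        dec-true (x e ≟ 1ℚ) (bit≥1⇒≡1 (ce-x e) (≤-trans (witness (1ℚ ≤? edgeUse (y κ) e) inS) (cd κ e)))
        where
          witness : ∀ {P : Set} (d : Dec P) → does d ≡ true → P
          witness (yes p) _ = p
          witness (no _) ()
      walk : Walk G S u v
      walk = flow⇒walk G (y κ) (ce-y κ) λ i → trans (cb κ i) (demand≡ κ i)
      s : Walk G S u v
      s = proj₁ (simplify G walk)
      s-path : IsPath G s
      s-path = proj₁ (proj₂ (simplify G walk))
      s′ : Walk G (selected G K t x) u v
      s′ = weaken G S⊆selected s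
      s′-short : len G s′ ≤ t * d
      s′-short = begin
        len G s′                               ≡⟨ len-weaken G S⊆selected s ⟩
        len G s                                ≤⟨ path-len≤cost G weight≥0 s s-path ⟩
        cost G S                               ≤⟨ support-cost≤ G weight≥0 (y κ) (bit≥0 ∘ ce-y κ) ⟩
        ∑ᴬ (λ a → y κ a * weight G (proj₁ a))  ≤⟨ ca κ d d-dist ⟩
        t * d                                  ∎
        where open ≤-Reasoning
      dF : ℚ
      dF = proj₁ (shortest G (selected G K t x) weight≥0 s′)
      dF-dist : IsDistIn G (selected G K t x) u v dF
      dF-dist = proj₂ (shortest G (selected G K t x) weight≥0 s′)

  spanner⇒solution : Connected G → ∀ F → IsSpanner G K t F →
    Σ[ x ∈ EVars G K t ] Σ[ y ∈ FVars G K t ] Feasible G K t x y × objective G K t x ≡ cost G F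
  spanner⇒solution connected F spanner = indicator , (arcUse G ∘ s) , feasible , objective≡
    where
      distance : ∀ κ → Σ ℚ (IsDist G (pu G K t κ) (pv G K t κ))
      distance κ = shortest G (allEdges G) weight≥0 (connected (pu G K t κ) (pv G K t κ))
      spannerPath : ∀ κ → Σ[ s ∈ Walk G F (pu G K t κ) (pv G K t κ) ] IsPath G s × len G s ≤ t * proj₁ (distance κ)
      spannerPath κ with spanner κ (proj₁ (distance κ)) (proj₂ (distance κ))
      ... | _ , ((w , refl) , _) , dF≤td with simplify G w
      ...   | s , s-path , s≼w = s , s-path , ≤-trans (≼⇒len≤ G weight≥0 s w s≼w) dF≤td
      s : ∀ κ → Walk G F (pu G K t κ) (pv G K t κ)
      s κ = proj₁ (spannerPath κ)
      s-path : ∀ κ → IsPath G (s κ)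
      s-path κ = proj₁ (proj₂ (spannerPath κ))
      indicator : EVars G K t
      indicator e = if F e then 1ℚ else 0ℚ
      indicator-bit : ∀ b → Bit (if b then 1ℚ else 0ℚ)
      indicator-bit true = inj₂ refl
      indicator-bit false = inj₁ refl
      feasible : Feasible G K t indicator (arcUse G ∘ s)
      feasible = record
        { ca = λ κ d d-dist → subst₂ _≤_ (trans (len≡along G (s κ)) (sym (∑ᴬ-arcUse G (s κ) (weight G ∘ proj₁))))
                                         (cong (t *_) (IsDistIn-unique G (proj₂ (distance κ)) d-dist))
                                         (proj₂ (proj₂ (spannerPath κ)))
        ; cb = λ κ i → trans (arcUse-conserves G (s κ) i) (sym (demand≡ κ i))
        ; cc = λ κ → path-outOf≤1 G (s κ) (s-path κ)
        ; cd = λ κ → path-edgeUse≤ G (s κ) (s-path κ)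
        ; ce-x = λ e → indicator-bit (F e)
        ; ce-y = λ κ → arcUse-bit G (s κ) (s-path κ)
        }
      objective≡ : objective G K t indicator ≡ cost G F
      objective≡ = ∑-cong λ e → trans (*-comm (weight G e) (indicator e)) (sym (if-then-0≡* (F e) (weight G e)))

theorem6 : ∀ {n m k : ℕ} (G : Graph n m)
    → Loopless G → Simple G → PositiveWeights G → Connected G
    → (t : ℚ) → 1ℚ ≤ t
    → (K : Fin k → Fin n × Fin n) → OrderedPairs K → NoRepeats K
    → (x : EVars G K t) (y : FVars G K t) → Optimal G K t x y
    → IsSpanner G K t (selected G K t x)
      × (∀ F → IsSpanner G K t F → cost G (selected G K t x) ≤ cost G F)
      × objective G K t x ≡ cost G (selected G K t x)
theorem6 G _ _ positive connected t _ K ordered _ x y (feasible , optimal) =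
  feasible⇒spanner feasible , minimal , objective≡cost G K t x (Feasible.ce-x feasible)
  where
    open Formulation G K t (λ e → <⇒≤ℚ (positive e)) (λ κ → <⇒≢ (ordered κ))
    minimal : ∀ F → IsSpanner G K t F → cost G (selected G K t x) ≤ cost G F
    minimal F spanner with spanner⇒solution connected F spanner
    ... | x′ , y′ , feasible′ , x′≡F = begin
      cost G (selected G K t x) ≡⟨ sym (objective≡cost G K t x (Feasible.ce-x feasible)) ⟩
      objective G K t x         ≤⟨ optimal x′ y′ feasible′ ⟩
      objective G K t x′        ≡⟨ x′≡F ⟩
      cost G F                  ∎
      where open ≤-Reasoning
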